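{- For graphs $G_1,G_2$, we have $r(L_{G_1},L_{G_2})\le r(G_1,G_2)+1$. In particular, $r(L_{K_s},L_{K_n})\le r(K_s,K_n)+1\le \binom{s+n-2}{s-1}+1$.
   Context: For graphs $G_1,G_2$, $r(G_1,G_2)$ is the smallest $N$ such that every graph on $N$ vertices contains $G_1$ or its complement contains $G_2$; the analogous definition is used for $3$-graphs ($3$-uniform hypergraphs). For a graph $G$, its link hypergraph $L_G$ is the $3$-graph on $V(G)\cup\{u\}$ ($u$ a new vertex) whose edges are the triples $\{u,v,w\}$ with $\{v,w\}\in E(G)$. $K_s$ is the complete graph on $s$ vertices. -}

module Defs where

open import Data.Nat using (ℕ; zero; suc; _≤_; _<_)
open import Data.Fin using (Fin; zero; suc; _≟_)
open import Data.Bool using (Bool; true; false; not; if_then_else_; _∧_; _∨_)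
open import Data.Product using (Σ; _×_; _,_)
open import Data.Sum using (_⊎_)
open import Relation.Nullary using (¬_)
open import Relation.Nullary.Decidable using (⌊_⌋)
open import Relation.Binary.PropositionalEquality using (_≡_; refl; sym)
open import Function.Definitions using (Injective)

record Graph (n : ℕ) : Set where
  field
    adj    : Fin n → Fin n → Bool
    symm   : ∀ v w → adj v w ≡ adj w v
    irrefl : ∀ v → adj v v ≡ false
open Graph public

complementAdj : ∀ {n} → Graph n → Fin n → Fin n → Bool
complementAdj G v w = if ⌊ v ≟ w ⌋ then false else not (adj G v w)

ContainsG : ∀ {k N} → (Fin k → Fin k → Bool) → (Fin N → Fin N → Bool) → Set
ContainsG {k} {N} H A =
  Σ (Fin k → Fin N) λ f → Injective _≡_ _≡_ f ×
    (∀ i j → H i j ≡ true → A (f i) (f j) ≡ true)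

Arrows : ∀ {k₁ k₂} → Graph k₁ → Graph k₂ → ℕ → Set
Arrows G₁ G₂ N =
  (G : Graph N) → ContainsG (adj G₁) (adj G) ⊎ ContainsG (adj G₂) (complementAdj G)

IsRamseyNumber : ∀ {k₁ k₂} → Graph k₁ → Graph k₂ → ℕ → Set
IsRamseyNumber G₁ G₂ r = Arrows G₁ G₂ r × (∀ N → N < r → ¬ Arrows G₁ G₂ N)

record Graph3 (n : ℕ) : Set where
  field
    edge   : Fin n → Fin n → Fin n → Bool
    sym12  : ∀ a b c → edge a b c ≡ edge b a c
    sym23  : ∀ a b c → edge a b c ≡ edge a c b
    degen  : ∀ a b → edge a a b ≡ false
open Graph3 public

distinct3 : ∀ {n} → Fin n → Fin n → Fin n → Bool
distinct3 a b c = not (⌊ a ≟ b ⌋ ∨ ⌊ b ≟ c ⌋ ∨ ⌊ a ≟ c ⌋)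

complementEdge : ∀ {n} → Graph3 n → Fin n → Fin n → Fin n → Bool
complementEdge H a b c = distinct3 a b c ∧ not (edge H a b c)

ContainsH : ∀ {k N} → (Fin k → Fin k → Fin k → Bool) → (Fin N → Fin N → Fin N → Bool) → Set
ContainsH {k} {N} H E =
  Σ (Fin k → Fin N) λ f → Injective _≡_ _≡_ f ×
    (∀ a b c → H a b c ≡ true → E (f a) (f b) (f c) ≡ true)

Arrows3 : ∀ {k₁ k₂} → Graph3 k₁ → Graph3 k₂ → ℕ → Set
Arrows3 H₁ H₂ N =
  (H : Graph3 N) → ContainsH (edge H₁) (edge H) ⊎ ContainsH (edge H₂) (complementEdge H)

IsRamseyNumber3 : ∀ {k₁ k₂} → Graph3 k₁ → Graph3 k₂ → ℕ → Set
IsRamseyNumber3 H₁ H₂ r = Arrows3 H₁ H₂ r × (∀ N → N < r → ¬ Arrows3 H₁ H₂ N)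

-- Link hypergraph L_G on Fin (suc k): the new vertex u is zero, the
-- vertex v of G is suc v; edges are {u,v,w} with vw ∈ E(G)

linkEdge : ∀ {k} → Graph k → Fin (suc k) → Fin (suc k) → Fin (suc k) → Bool
linkEdge G zero    (suc v) (suc w) = adj G v w
linkEdge G (suc v) zero    (suc w) = adj G v w
linkEdge G (suc v) (suc w) zero    = adj G v w
linkEdge G _       _       _       = false

Link : ∀ {k} → Graph k → Graph3 (suc k)
Link G = record { edge = linkEdge G ; sym12 = s12 ; sym23 = s23 ; degen = dg }
  where
  s12 : ∀ a b c → linkEdge G a b c ≡ linkEdge G b a c
  s12 zero zero c = refl
  s12 zero (suc b) zero = refl
  s12 zero (suc b) (suc c) = refl
  s12 (suc a) zero zero = refl
  s12 (suc a) zero (suc c) = refl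
  s12 (suc a) (suc b) zero = symm G a b
  s12 (suc a) (suc b) (suc c) = refl
  s23 : ∀ a b c → linkEdge G a b c ≡ linkEdge G a c b
  s23 zero zero zero = refl
  s23 zero zero (suc c) = refl
  s23 zero (suc b) zero = refl
  s23 zero (suc b) (suc c) = symm G b c
  s23 (suc a) zero zero = refl
  s23 (suc a) zero (suc c) = refl
  s23 (suc a) (suc b) zero = refl
  s23 (suc a) (suc b) (suc c) = refl
  dg : ∀ a b → linkEdge G a a b ≡ false
  dg zero zero = refl
  dg zero (suc b) = refl
  dg (suc a) zero = irrefl G a
  dg (suc a) (suc b) = refl

completeAdj : ∀ {s} → Fin s → Fin s → Bool
completeAdj v w = not ⌊ v ≟ w ⌋

K : (s : ℕ) → Graph s
K s = record { adj = completeAdj ; symm = sy ; irrefl = ir }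
  where
  sy : ∀ v w → completeAdj v w ≡ completeAdj w v
  sy v w with v ≟ w | w ≟ v
  ... | Relation.Nullary.yes _ | Relation.Nullary.yes _ = refl
  ... | Relation.Nullary.yes p | Relation.Nullary.no q = Data.Empty.⊥-elim (q (sym p))
    where import Data.Empty
  ... | Relation.Nullary.no p | Relation.Nullary.yes q = Data.Empty.⊥-elim (p (sym q))
    where import Data.Empty
  ... | Relation.Nullary.no _ | Relation.Nullary.no _ = refl
  ir : ∀ v → completeAdj v v ≡ false
  ir v with v ≟ v
  ... | Relation.Nullary.yes _ = refl
  ... | Relation.Nullary.no p = Data.Empty.⊥-elim (p refl)
    where import Data.Empty

-- The link of a vertex u in a 3-graph H on N + 1 vertices is a graph on the other N vertices.
-- A copy of G₁ in it, together with u, is a copy of L_{G₁} in H, and a copy of G₂ in its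
-- complement, together with u, is a copy of L_{G₂} in the complement of H.  So if every graph
-- on N vertices contains G₁ or has G₂ in its complement, every 3-graph on N + 1 vertices
-- contains L_{G₁} or has L_{G₂} in its complement.  The binomial bound on r(K_s,K_n) is the
-- Erdős–Szekeres recursion: by Pascal's rule, the neighbours or the non-neighbours of one
-- vertex are numerous enough to continue in.
module Submission where

open import Defs
open import Data.Nat using (ℕ; zero; suc; _≤_; _<_; _∸_; _+_; z≤n; s≤s)
open import Data.Nat.Properties
open import Data.Nat.Combinatorics using (_C_; nCn≡1; nCk+nC[k+1]≡[n+1]C[k+1])
open import Data.Fin using (Fin; zero; suc; lift) renaming (_≟_ to _≟F_)
open import Data.Fin.Properties using (lift-injective)
open import Data.Bool using (Bool; true; false; not; _∧_; _∨_) renaming (_≟_ to _≟B_)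
open import Data.Bool.Properties using (∨-comm; ∨-assoc; ¬-not)
open import Data.Product using (_×_; _,_; proj₁; proj₂)
open import Data.Sum using (_⊎_; inj₁; inj₂)
import Data.Sum as Sum
open import Data.Empty using (⊥-elim)
open import Data.List using (List; []; _∷_; length; filter; allFin)
open import Data.List.Properties using (length-tabulate)
open import Data.List.Membership.Propositional using (_∈_; _∉_)
open import Data.List.Membership.Propositional.Properties using (∈-filter⁻)
open import Data.List.Relation.Unary.Any using (here; there)
open import Data.List.Relation.Unary.AllPairs using (_∷_)
open import Data.List.Relation.Unary.Unique.Propositional using (Unique)
open import Data.List.Relation.Unary.Unique.Propositional.Properties
  using (Unique[x∷xs]⇒x∉xs; filter⁺; allFin⁺)
open import Data.List.Relation.Binary.Subset.Propositional using (_⊆_)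
open import Data.List.Relation.Binary.Subset.Propositional.Properties using (filter-⊆)
open import Relation.Nullary using (¬_; yes; no)
open import Relation.Nullary.Decidable using (⌊_⌋)
open import Relation.Unary using (Pred; Decidable)
open import Relation.Unary.Properties using (∁?)
open import Relation.Binary.PropositionalEquality
open import Function using (_∘_)
open import Function.Definitions using (Injective)

minimal⇒≤ : {P : ℕ → Set} {r N : ℕ} → (∀ M → M < r → ¬ P M) → P N → r ≤ N
minimal⇒≤ {N = N} minimal pN = ≮⇒≥ (λ N<r → minimal N N<r pN)

⌊≟⌋-sym : ∀ {n} (a b : Fin n) → ⌊ a ≟F b ⌋ ≡ ⌊ b ≟F a ⌋
⌊≟⌋-sym a b with a ≟F b | b ≟F a
... | yes _   | yes _   = refl
... | yes a≡b | no b≢a  = ⊥-elim (b≢a (sym a≡b))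
... | no a≢b  | yes b≡a = ⊥-elim (a≢b (sym b≡a))
... | no _    | no _    = refl

completeAdj-suc : ∀ {k} (i j : Fin k) → completeAdj (suc i) (suc j) ≡ completeAdj i j
completeAdj-suc i j with i ≟F j
... | yes _ = refl
... | no _  = refl

containsG-mono : ∀ {k N} {H : Fin k → Fin k → Bool} {A B : Fin N → Fin N → Bool} →
  (∀ v w → A v w ≡ true → B v w ≡ true) → ContainsG H A → ContainsG H B
containsG-mono A⇒B (f , f-inj , f-hom) = f , f-inj , λ i j e → A⇒B (f i) (f j) (f-hom i j e)

module _ {N : ℕ} (G : Graph N) where

  complementAdj-sym : ∀ v w → complementAdj G v w ≡ complementAdj G w v
  complementAdj-sym v w rewrite ⌊≟⌋-sym v w | symm G v w = refl

  complementAdj-true : ∀ {v w} → v ≢ w → adj G v w ≡ false → complementAdj G v w ≡ true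
  complementAdj-true {v} {w} v≢w nonadj with v ≟F w
  ... | yes v≡w = ⊥-elim (v≢w v≡w)
  ... | no _ rewrite nonadj = refl

module _ {a p} {A : Set a} {P : Pred A p} (P? : Decidable P) where

  length-filter-∁ : ∀ xs → length (filter P? xs) + length (filter (∁? P?) xs) ≡ length xs
  length-filter-∁ [] = refl
  length-filter-∁ (x ∷ xs) with P? x
  ... | yes _ = cong suc (length-filter-∁ xs)
  ... | no _  = trans (+-suc _ _) (cong suc (length-filter-∁ xs))

pascal : ∀ a b → (suc a + suc b) C suc a ≡ (a + suc b) C a + (suc a + b) C suc a
pascal a b = begin
  suc (a + suc b) C suc a                 ≡⟨ nCk+nC[k+1]≡[n+1]C[k+1] (a + suc b) a ⟨
  (a + suc b) C a + (a + suc b) C suc a   ≡⟨ cong (λ m → (a + suc b) C a + m C suc a) (+-suc a b) ⟩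
  (a + suc b) C a + (suc a + b) C suc a   ∎
  where open ≡-Reasoning

0<[a+b]Ca : ∀ a b → 0 < (a + b) C a
0<[a+b]Ca zero    b       = s≤s z≤n
0<[a+b]Ca (suc a) zero    = ≤-reflexive (sym (trans (cong (_C suc a) (+-identityʳ (suc a))) (nCn≡1 (suc a))))
0<[a+b]Ca (suc a) (suc b) =
  ≤-trans (0<[a+b]Ca a (suc b)) (≤-trans (m≤m+n _ _) (≤-reflexive (sym (pascal a b))))

pigeonhole-+ : ∀ x y p q → x + y ≤ suc (p + q) → x ≤ p ⊎ y ≤ q
pigeonhole-+ x y p q h with x ≤? p
... | yes x≤p = inj₁ x≤p
... | no x≰p  = inj₂ (+-cancelˡ-≤ (suc p) y q (≤-trans (+-monoˡ-≤ y (≰⇒> x≰p)) h))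

record CliqueIn {N : ℕ} (R : Fin N → Fin N → Bool) (k : ℕ) (L : List (Fin N)) : Set where
  field
    vertex    : Fin k → Fin N
    injective : Injective _≡_ _≡_ vertex
    inside    : ∀ i → vertex i ∈ L
    related   : ∀ i j → completeAdj i j ≡ true → R (vertex i) (vertex j) ≡ true

  containsK : ContainsG completeAdj R
  containsK = vertex , injective , related

module _ {N : ℕ} {R : Fin N → Fin N → Bool} where

  singletonClique : ∀ {v L} → v ∈ L → CliqueIn R 1 L
  singletonClique {v} v∈L = record
    { vertex = λ _ → v ; injective = λ { {zero} {zero} _ → refl }
    ; inside = λ _ → v∈L ; related = λ { zero zero () } }

  cliqueIn-⊆ : ∀ {k L L′} → L ⊆ L′ → CliqueIn R k L → CliqueIn R k L′
  cliqueIn-⊆ L⊆L′ clique = record { CliqueIn clique ; inside = λ i → L⊆L′ (CliqueIn.inside clique i) }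

  cliqueIn-∷ : (∀ v w → R v w ≡ R w v) → ∀ {k v L L′} → v ∉ L → L′ ⊆ L →
    (∀ {w} → w ∈ L′ → R v w ≡ true) → CliqueIn R k L′ → CliqueIn R (suc k) (v ∷ L)
  cliqueIn-∷ R-sym {k} {v} {L} {L′} v∉L L′⊆L v~L′ clique = record
    { vertex = vertex′ ; injective = injective′ ; inside = inside′ ; related = related′ }
    where
    open CliqueIn clique
    vertex′ : Fin (suc k) → Fin N
    vertex′ zero    = v
    vertex′ (suc i) = vertex i
    v≢vertex : ∀ i → v ≢ vertex i
    v≢vertex i v≡ = v∉L (subst (_∈ L) (sym v≡) (L′⊆L (inside i)))
    injective′ : Injective _≡_ _≡_ vertex′
    injective′ {zero}  {zero}  _ = refl
    injective′ {zero}  {suc j} e = ⊥-elim (v≢vertex j e)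
    injective′ {suc i} {zero}  e = ⊥-elim (v≢vertex i (sym e))
    injective′ {suc i} {suc j} e = cong suc (injective e)
    inside′ : ∀ i → vertex′ i ∈ v ∷ L
    inside′ zero    = here refl
    inside′ (suc i) = there (L′⊆L (inside i))
    related′ : ∀ i j → completeAdj i j ≡ true → R (vertex′ i) (vertex′ j) ≡ true
    related′ zero    zero    ()
    related′ zero    (suc j) _ = v~L′ (inside j)
    related′ (suc i) zero    _ = trans (R-sym (vertex i) v) (v~L′ (inside i))
    related′ (suc i) (suc j) e = related i j (trans (sym (completeAdj-suc i j)) e)

module _ {N : ℕ} (G : Graph N) where

  adjacent? : ∀ v → Decidable (λ w → adj G v w ≡ true)
  adjacent? v w = adj G v w ≟B true

  neighbours nonNeighbours : Fin N → List (Fin N) → List (Fin N)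
  neighbours    v = filter (adjacent? v)
  nonNeighbours v = filter (∁? (adjacent? v))

  addNeighbour : ∀ {k v L} → v ∉ L →
    CliqueIn (adj G) k (neighbours v L) → CliqueIn (adj G) (suc k) (v ∷ L)
  addNeighbour {v = v} {L} v∉L =
    cliqueIn-∷ (symm G) v∉L (filter-⊆ (adjacent? v) L) (λ w∈ → proj₂ (∈-filter⁻ (adjacent? v) {xs = L} w∈))

  addNonNeighbour : ∀ {k v L} → v ∉ L →
    CliqueIn (complementAdj G) k (nonNeighbours v L) → CliqueIn (complementAdj G) (suc k) (v ∷ L)
  addNonNeighbour {v = v} {L} v∉L =
    cliqueIn-∷ (complementAdj-sym G) v∉L (filter-⊆ (∁? (adjacent? v)) L) nonadjacent
    where
    nonadjacent : ∀ {w} → w ∈ nonNeighbours v L → complementAdj G v w ≡ true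
    nonadjacent w∈ with ∈-filter⁻ (∁? (adjacent? v)) {xs = L} w∈
    ... | w∈L , ¬adjacent =
      complementAdj-true G (λ { refl → v∉L w∈L }) (¬-not ¬adjacent)

  neighbourhood-split : ∀ a b v L → (suc a + suc b) C suc a ≤ length (v ∷ L) →
    (a + suc b) C a + (suc a + b) C suc a ≤ suc (length (neighbours v L) + length (nonNeighbours v L))
  neighbourhood-split a b v L = subst₂ _≤_ (pascal a b) (cong suc (sym (length-filter-∁ (adjacent? v) L)))

  erdős-szekeres : ∀ a b (L : List (Fin N)) → Unique L → (a + b) C a ≤ length L →
    CliqueIn (adj G) (suc a) L ⊎ CliqueIn (complementAdj G) (suc b) L
  erdős-szekeres a b [] _ big = ⊥-elim (<⇒≱ (0<[a+b]Ca a b) big)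
  erdős-szekeres zero    b       (v ∷ _) _ _ = inj₁ (singletonClique (here refl))
  erdős-szekeres (suc a) zero    (v ∷ _) _ _ = inj₂ (singletonClique (here refl))
  erdős-szekeres (suc a) (suc b) (v ∷ L) unique@(_ ∷ uniqueL) big
    with pigeonhole-+ _ _ _ _ (neighbourhood-split a b v L big)
  ... | inj₁ few = Sum.map (addNeighbour (Unique[x∷xs]⇒x∉xs unique)) (cliqueIn-⊆ (there ∘ filter-⊆ _ L))
                     (erdős-szekeres a (suc b) (neighbours v L) (filter⁺ _ uniqueL) few)
  ... | inj₂ few = Sum.map (cliqueIn-⊆ (there ∘ filter-⊆ _ L)) (addNonNeighbour (Unique[x∷xs]⇒x∉xs unique))
                     (erdős-szekeres (suc a) b (nonNeighbours v L) (filter⁺ _ uniqueL) few)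

arrows-complete : ∀ a b → Arrows (K (suc a)) (K (suc b)) ((a + b) C a)
arrows-complete a b G =
  Sum.map CliqueIn.containsK CliqueIn.containsK
    (erdős-szekeres G a b (allFin M) (allFin⁺ M) (≤-reflexive (sym (length-tabulate (λ i → i)))))
  where M = (a + b) C a

distinct3-swap₁₂ : ∀ {n} (a b c : Fin n) → distinct3 a b c ≡ distinct3 b a c
distinct3-swap₁₂ a b c rewrite ⌊≟⌋-sym a b = cong (λ x → not (⌊ b ≟F a ⌋ ∨ x)) (∨-comm ⌊ b ≟F c ⌋ ⌊ a ≟F c ⌋)

distinct3-swap₂₃ : ∀ {n} (a b c : Fin n) → distinct3 a b c ≡ distinct3 a c b
distinct3-swap₂₃ a b c rewrite ⌊≟⌋-sym b c = cong not (∨-reverse ⌊ a ≟F b ⌋ ⌊ c ≟F b ⌋ ⌊ a ≟F c ⌋)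
  where
  ∨-reverse : ∀ x y z → x ∨ y ∨ z ≡ z ∨ y ∨ x
  ∨-reverse x y z = trans (∨-comm x (y ∨ z)) (trans (cong (_∨ x) (∨-comm y z)) (∨-assoc z y x))

complement₃ : ∀ {n} → Graph3 n → Graph3 n
complement₃ H = record
  { edge  = complementEdge H
  ; sym12 = λ a b c → cong₂ _∧_ (distinct3-swap₁₂ a b c) (cong not (sym12 H a b c))
  ; sym23 = λ a b c → cong₂ _∧_ (distinct3-swap₂₃ a b c) (cong not (sym23 H a b c))
  ; degen = degenerate
  }
  where
  degenerate : ∀ a b → complementEdge H a a b ≡ false
  degenerate a b with a ≟F a
  ... | yes _   = refl
  ... | no a≢a = ⊥-elim (a≢a refl)

module _ {N : ℕ} (H : Graph3 (suc N)) where

  link₀ : Graph N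
  link₀ = record
    { adj    = λ v w → edge H zero (suc v) (suc w)
    ; symm   = λ v w → sym23 H zero (suc v) (suc w)
    ; irrefl = λ v → trans (sym12 H zero (suc v) (suc v))
                     (trans (sym23 H (suc v) zero (suc v)) (degen H (suc v) zero))
    }

  link₀-embedding : ∀ {k} (G : Graph k) → ContainsG (adj G) (adj link₀) → ContainsH (linkEdge G) (edge H)
  link₀-embedding G (f , f-inj , f-hom) = lift 1 f , lift-injective f f-inj 1 , hom
    where
    hom : ∀ a b c → linkEdge G a b c ≡ true → edge H (lift 1 f a) (lift 1 f b) (lift 1 f c) ≡ true
    hom zero    (suc b) (suc c) e = f-hom b c e
    hom (suc a) zero    (suc c) e = trans (sym12 H (suc (f a)) zero (suc (f c))) (f-hom a c e)
    hom (suc a) (suc b) zero    e =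
      trans (sym23 H (suc (f a)) (suc (f b)) zero)
        (trans (sym12 H (suc (f a)) zero (suc (f b))) (f-hom a b e))
    hom zero    zero    _       ()
    hom zero    (suc b) zero    ()
    hom (suc a) zero    zero    ()
    hom (suc a) (suc b) (suc c) ()

  complement-link₀ : ∀ v w → complementAdj link₀ v w ≡ true → edge (complement₃ H) zero (suc v) (suc w) ≡ true
  complement-link₀ v w e with v ≟F w
  complement-link₀ v w () | yes _
  ... | no _ = e

arrows-link : ∀ {k₁ k₂ N} {G₁ : Graph k₁} {G₂ : Graph k₂} →
  Arrows G₁ G₂ N → Arrows3 (Link G₁) (Link G₂) (suc N)
arrows-link {G₁ = G₁} {G₂} arrows H with arrows (link₀ H)
... | inj₁ copy = inj₁ (link₀-embedding H G₁ copy)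
... | inj₂ copy = inj₂ (link₀-embedding (complement₃ H) G₂ (containsG-mono (complement-link₀ H) copy))

ramsey-link-≤ : ∀ {k₁ k₂ r} {G₁ : Graph k₁} {G₂ : Graph k₂} → IsRamseyNumber G₁ G₂ r →
  ∀ r′ → IsRamseyNumber3 (Link G₁) (Link G₂) r′ → r′ ≤ suc r
ramsey-link-≤ (arrows , _) r′ (_ , minimal) = minimal⇒≤ minimal (arrows-link arrows)

ramsey-complete-≤ : ∀ a b {r} → IsRamseyNumber (K (suc a)) (K (suc b)) r → r ≤ (a + b) C a
ramsey-complete-≤ a b (_ , minimal) = minimal⇒≤ minimal (arrows-complete a b)

proposition6p3 : (∀ {k₁ k₂} (G₁ : Graph k₁) (G₂ : Graph k₂) (r : ℕ) → IsRamseyNumber G₁ G₂ r →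
    Arrows3 (Link G₁) (Link G₂) (suc r) ×
    (∀ r′ → IsRamseyNumber3 (Link G₁) (Link G₂) r′ → r′ ≤ suc r))
    ×
    (∀ (s n : ℕ) → 1 ≤ s → 1 ≤ n → (r : ℕ) → IsRamseyNumber (K s) (K n) r →
    (∀ r′ → IsRamseyNumber3 (Link (K s)) (Link (K n)) r′ → r′ ≤ suc r) ×
    r ≤ (s + n ∸ 2) C (s ∸ 1))
proposition6p3 =
  (λ G₁ G₂ r isRamsey → arrows-link (proj₁ isRamsey) , ramsey-link-≤ isRamsey) ,
  λ { (suc a) (suc b) _ _ r isRamsey →
        ramsey-link-≤ isRamsey ,
        subst (r ≤_) (cong (λ m → (m ∸ 1) C a) (sym (+-suc a b))) (ramsey-complete-≤ a b isRamsey) }
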